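{- Let $m\ge 2$ and $n\ge 5$ be integers. Then $\chi'_g(W_n;m,1)=n$.
   Context: For $n\ge 3$, the wheel $W_n$ is the graph with $n+1$ vertices obtained from the cycle $C_n$ by adding a new vertex $v_0$ adjacent to every vertex of the cycle. The $(m,1)$-edge coloring game on a finite simple graph $G$ with a set of colors $X$ is played alternately by two players, Maker and Breaker, with Maker playing first. On each turn Maker makes $m$ moves and Breaker makes one move; a move consists of coloring one uncolored edge of $G$ with a color from $X$ so that adjacent edges (edges sharing an endpoint) always receive distinct colors. Maker wins if eventually every edge is colored; Breaker wins if at some point the player who is to move cannot color any edge. The $(m,1)$-game chromatic index $\chi'_g(G;m,1)$ is the smallest nonnegative integer $k$ such that Maker has a winning strategy when $|X|=k$. -}

module Defs where

open import Data.Nat using (ℕ; zero; suc; _+_; _<_)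
open import Data.Nat.DivMod using (_mod_)
open import Data.Fin using (Fin; zero; suc; toℕ; splitAt; _≟_)
open import Data.Maybe using (Maybe; just; nothing; Is-just)
open import Data.Product using (_×_; _,_; ∃; ∃₂)
open import Data.Sum using (_⊎_; inj₁; inj₂)
open import Relation.Nullary using (¬_; yes; no)
open import Relation.Binary.PropositionalEquality using (_≡_; _≢_)

record Graph : Set where
  field
    nV   : ℕ
    nE   : ℕ
    ends : Fin nE → Fin nV × Fin nV
open Graph public

SharesEnd : (G : Graph) → Fin (nE G) → Fin (nE G) → Set
SharesEnd G e e' with ends G e | ends G e'
... | a , b | c , d = (a ≡ c) ⊎ (a ≡ d) ⊎ (b ≡ c) ⊎ (b ≡ d)

Adjacent : (G : Graph) → Fin (nE G) → Fin (nE G) → Set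
Adjacent G e e' = (e ≢ e') × SharesEnd G e e'

cycNext : {n : ℕ} → Fin n → Fin n
cycNext {suc p} i = (suc (toℕ i)) mod (suc p)

-- Wheel W_n: vertex 0 is the hub v₀, vertex (suc i) is cycle vertex i.
-- Edges 0..n-1 are spokes v₀ – vᵢ; edges n..2n-1 are rim edges vᵢ – v_{i+1 mod n}.
Wheel : ℕ → Graph
Wheel n = record { nV = suc n ; nE = n + n ; ends = e }
  where
  e : Fin (n + n) → Fin (suc n) × Fin (suc n)
  e x with splitAt n x
  ... | inj₁ i = zero , suc i
  ... | inj₂ i = suc i , suc (cycNext i)

Colouring : Graph → ℕ → Set
Colouring G k = Fin (nE G) → Maybe (Fin k)

Legal : (G : Graph) (k : ℕ) → Colouring G k → Fin (nE G) → Fin k → Set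
Legal G k col e c = (col e ≡ nothing) × (∀ e' → Adjacent G e e' → col e' ≢ just c)

update : {G : Graph} {k : ℕ} → Colouring G k → Fin (nE G) → Fin k → Colouring G k
update col e c e' with e' ≟ e
... | yes _ = just c
... | no  _ = col e'

AllColoured : (G : Graph) (k : ℕ) → Colouring G k → Set
AllColoured G k col = ∀ e → Is-just (col e)

-- Whose move it is: Maker with r (≥ 1) moves left in the current turn, or Breaker.
data Turn : Set where
  maker   : ℕ → Turn
  breaker : Turn

afterMaker : ℕ → Turn
afterMaker zero    = breaker
afterMaker (suc r) = maker (suc r)

-- MakerWins G m k col t : from position (col, t) of the (m,1)-edge colouring
-- game on G with k colours, Maker has a winning strategy.  (The game is finite,
-- so this inductive predicate is exactly the existence of a winning strategy.)
data MakerWins (G : Graph) (m k : ℕ) : Colouring G k → Turn → Set where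
  done    : ∀ {col t} → AllColoured G k col → MakerWins G m k col t
  mMove   : ∀ {col r} (e : Fin (nE G)) (c : Fin k) → Legal G k col e c →
            MakerWins G m k (update {G} col e c) (afterMaker r) →
            MakerWins G m k col (maker (suc r))
  bMove   : ∀ {col} →
            -- Breaker is able to move (otherwise Breaker has won)
            ∃₂ (λ e c → Legal G k col e c) →
            (∀ e c → Legal G k col e c → MakerWins G m k (update {G} col e c) (maker m)) →
            MakerWins G m k col breaker

emptyColouring : (G : Graph) (k : ℕ) → Colouring G k
emptyColouring G k _ = nothing

MakerHasWinningStrategy : Graph → ℕ → ℕ → Set
MakerHasWinningStrategy G m k = MakerWins G m k (emptyColouring G k) (maker m)

GameChromaticIndexIs : Graph → ℕ → ℕ → Set
GameChromaticIndexIs G m χ =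
  MakerHasWinningStrategy G m χ × (∀ k → k < χ → ¬ MakerHasWinningStrategy G m k)

-- The n spokes pairwise share the hub, so a complete proper edge colouring gives them n distinct colours;
-- with fewer colours the game can never end with every edge coloured (pigeonhole), whatever Maker does.
--
-- With n colours Maker secures the spokes first. She keeps every position "guarded": a rim edge whose
-- colour appears on no spoke has both end spokes coloured. Then a colour missing from the spokes, which
-- exists while some spoke is open, is legal on every open spoke. Breaker can spoil this only by putting
-- such a colour on a rim edge beside an open spoke; Maker answers by playing the same colour on an open
-- spoke away from that edge, and she ends each turn so that such a "spare" spoke exists. Once all spokes
-- are coloured each rim edge sees at most four colours, so with n ≥ 5 every rim edge stays colourable.
-- For n ≥ 6 there is always room for Maker's manoeuvres; for n = 5 she must also pace the number of open
-- spokes against her moves per turn, and the openings for m = 2 and m = 4 are played by hand.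

module Submission where

open import Defs
open import Data.Bool using (if_then_else_)
open import Data.Empty using (⊥; ⊥-elim)
open import Data.Fin as Fin using (Fin; zero; suc; #_; toℕ; punchIn; punchOut; _↑ˡ_; _↑ʳ_; splitAt; join)
import Data.Fin.Properties as Finₚ
open import Data.Maybe using (Maybe; just; nothing; Is-just)
open import Data.Maybe.Relation.Unary.Any using (just)
import Data.Maybe.Properties as Maybeₚ
open import Data.Nat as ℕ using (ℕ; zero; suc; _+_; _∸_; _≤_; _<_; z≤n; s≤s; _%_; NonZero)
import Data.Nat.Properties as ℕₚ
open import Data.Nat.DivMod using (%-distribˡ-+; m%n%n≡m%n; [m+n]%n≡m%n; m<n⇒m%n≡m; m≤n⇒[n∸m]%m≡n%m)
open import Data.Product using (_×_; _,_; ∃; ∃₂; proj₁; proj₂)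
open import Data.Sum as Sum using (_⊎_; inj₁; inj₂)
open import Data.Unit using (tt)
open import Function using (_∘_)
open import Relation.Nullary using (¬_; Dec; yes; no; does; ¬?)
open import Relation.Nullary.Decidable using (map′; decidable-stable)
open import Relation.Unary using (Decidable)
open import Relation.Binary.PropositionalEquality
  using (_≡_; _≢_; refl; sym; trans; cong; subst; module ≡-Reasoning)

open ≡-Reasoning

count : ∀ {k} {P : Fin k → Set} → Decidable P → ℕ
count {zero}  P? = 0
count {suc k} P? = (if does (P? zero) then 1 else 0) + count (P? ∘ suc)

_∖_ : ∀ {k} {P : Fin k → Set} → Decidable P → (a : Fin k) → Decidable (λ i → P i × i ≢ a)
(P? ∖ a) i with i Fin.≟ a
... | yes i≡a = no λ (_ , i≢a) → i≢a i≡a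
... | no  i≢a = map′ (_, i≢a) proj₁ (P? i)

count-cong : ∀ {k} {P Q : Fin k → Set} (P? : Decidable P) (Q? : Decidable Q) →
             (∀ i → P i → Q i) → (∀ i → Q i → P i) → count P? ≡ count Q?
count-cong {zero}  P? Q? P⇒Q Q⇒P = refl
count-cong {suc k} P? Q? P⇒Q Q⇒P with P? zero | Q? zero
... | yes _ | yes _ = cong suc (count-cong (P? ∘ suc) (Q? ∘ suc) (P⇒Q ∘ suc) (Q⇒P ∘ suc))
... | no  _ | no  _ = count-cong (P? ∘ suc) (Q? ∘ suc) (P⇒Q ∘ suc) (Q⇒P ∘ suc)
... | yes p | no ¬q = ⊥-elim (¬q (P⇒Q zero p))
... | no ¬p | yes q = ⊥-elim (¬p (Q⇒P zero q))

count-∖ : ∀ {k} {P : Fin k → Set} (P? : Decidable P) {a} → P a → count P? ≡ suc (count (P? ∖ a))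
count-∖ {suc k} P? {zero} pa with P? zero
... | yes _ = cong suc (count-cong (P? ∘ suc) ((P? ∖ zero) ∘ suc) (λ _ p → p , λ ()) (λ _ → proj₁))
... | no ¬p = ⊥-elim (¬p pa)
count-∖ {suc k} {P} P? {suc a} pa = begin
  b + count (P? ∘ suc)              ≡⟨ cong (b +_) (count-∖ (P? ∘ suc) pa) ⟩
  b + suc (count ((P? ∘ suc) ∖ a))  ≡⟨ ℕₚ.+-suc b _ ⟩
  suc (b + count ((P? ∘ suc) ∖ a))  ≡⟨ cong (λ x → suc (b + x)) (count-cong _ _ shift unshift) ⟩
  suc (count (P? ∖ suc a))          ∎
  where
  b : ℕ
  b = if does (P? zero) then 1 else 0
  shift : ∀ i → P (suc i) × i ≢ a → P (suc i) × suc i ≢ suc a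
  shift i (p , i≢a) = p , i≢a ∘ Finₚ.suc-injective
  unshift : ∀ i → P (suc i) × suc i ≢ suc a → P (suc i) × i ≢ a
  unshift i (p , si≢sa) = p , si≢sa ∘ cong suc

count≡0⇒¬ : ∀ {k} {P : Fin k → Set} (P? : Decidable P) → count P? ≡ 0 → ∀ i → ¬ P i
count≡0⇒¬ {suc k} P? eq i p with P? zero
count≡0⇒¬ {suc k} P? () i p | yes _
count≡0⇒¬ {suc k} P? eq zero p    | no ¬p = ¬p p
count≡0⇒¬ {suc k} P? eq (suc i) p | no _  = count≡0⇒¬ (P? ∘ suc) eq i p

count≡suc⇒∃ : ∀ {k} {P : Fin k → Set} (P? : Decidable P) {x} → count P? ≡ suc x → ∃ P
count≡suc⇒∃ {suc k} P? eq with P? zero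
... | yes p = zero , p
... | no _  = let a , pa = count≡suc⇒∃ (P? ∘ suc) eq in suc a , pa

count-pick : ∀ {k} {P : Fin k → Set} (P? : Decidable P) {x} → count P? ≡ suc x →
             ∃ λ a → P a × count (P? ∖ a) ≡ x
count-pick P? eq =
  let a , pa = count≡suc⇒∃ P? eq in a , pa , ℕₚ.suc-injective (trans (sym (count-∖ P? pa)) eq)

module _ {j N : ℕ} (forb : Fin j → Maybe (Fin N)) where

  Avoids : Fin N → Set
  Avoids c = ∀ t → forb t ≢ just c

  avoids? : Decidable Avoids
  avoids? c = Finₚ.all? (λ t → ¬? (Maybeₚ.≡-dec Fin._≟_ (forb t) (just c)))

  ¬avoids⇒hit : ∀ c → ¬ Avoids c → ∃ λ t → forb t ≡ just c
  ¬avoids⇒hit c ¬avoids =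
    let t , ¬¬hit = Finₚ.¬∀⟶∃¬ j _ (λ t → ¬? (Maybeₚ.≡-dec Fin._≟_ (forb t) (just c))) ¬avoids
    in t , decidable-stable (Maybeₚ.≡-dec Fin._≟_ (forb t) (just c)) ¬¬hit

  pigeonhole-avoid : ∀ {k} → j < k → (cand : Fin k → Fin N) → (∀ {a b} → cand a ≡ cand b → a ≡ b) →
                     ∃ λ a → Avoids (cand a)
  pigeonhole-avoid j<k cand cand-inj with Finₚ.any? (avoids? ∘ cand)
  ... | yes found = found
  ... | no none =
    let a , a' , a<a' , same = Finₚ.pigeonhole j<k (proj₁ ∘ hitOf)
    in ⊥-elim (Finₚ.<⇒≢ a<a' (cand-inj (Maybeₚ.just-injective (begin
         just (cand a)         ≡⟨ sym (proj₂ (hitOf a)) ⟩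
         forb (proj₁ (hitOf a))  ≡⟨ cong forb same ⟩
         forb (proj₁ (hitOf a')) ≡⟨ proj₂ (hitOf a') ⟩
         just (cand a')        ∎))))
    where
    hitOf : ∀ a → ∃ λ t → forb t ≡ just (cand a)
    hitOf a = ¬avoids⇒hit (cand a) (none ∘ (a ,_))

avoids-punchIn : ∀ {j N} (forb : Fin (suc j) → Maybe (Fin N)) {s c} → forb s ≡ nothing →
                 Avoids (forb ∘ punchIn s) c → Avoids forb c
avoids-punchIn forb {s} hole avoids t hit with t Fin.≟ s
... | yes refl with () ← trans (sym hole) hit
... | no t≢s = avoids (punchOut (t≢s ∘ sym)) (trans (cong forb (Finₚ.punchIn-punchOut (t≢s ∘ sym))) hit)

unused-colour : ∀ {k} (h : Fin k → Maybe (Fin k)) {s} → h s ≡ nothing → ∃ (Avoids h)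
unused-colour {suc k} h {s} hole =
  let c , avoids = pigeonhole-avoid (h ∘ punchIn s) ℕₚ.≤-refl (λ c → c) (λ eq → eq)
  in c , avoids-punchIn h hole avoids

avoid-two : ∀ {N} (a b : Fin N) → a ≢ b →
            ∃ λ (g : Fin (N ∸ 2) → Fin N) → (∀ {s t} → g s ≡ g t → s ≡ t) × (∀ t → g t ≢ a × g t ≢ b)
avoid-two {suc zero} zero zero a≢b = ⊥-elim (a≢b refl)
avoid-two {suc (suc q)} a b a≢b = g , g-injective , λ t → Finₚ.punchInᵢ≢i a _ , g≢b t
  where
  b' : Fin (suc q)
  b' = punchOut a≢b
  g : Fin q → Fin (suc (suc q))
  g t = punchIn a (punchIn b' t)
  g-injective : ∀ {s t} → g s ≡ g t → s ≡ t
  g-injective eq = Finₚ.punchIn-injective b' _ _ (Finₚ.punchIn-injective a _ _ eq)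
  g≢b : ∀ t → g t ≢ b
  g≢b t eq = Finₚ.punchInᵢ≢i b' t (Finₚ.punchIn-injective a _ _ (trans eq (sym (Finₚ.punchIn-punchOut a≢b))))

[m+n%d]%d≡[m+n]%d : ∀ m n d .{{_ : NonZero d}} → (m + n % d) % d ≡ (m + n) % d
[m+n%d]%d≡[m+n]%d m n d = begin
  (m + n % d) % d          ≡⟨ %-distribˡ-+ m (n % d) d ⟩
  (m % d + n % d % d) % d  ≡⟨ cong (λ x → (m % d + x) % d) (m%n%n≡m%n n d) ⟩
  (m % d + n % d) % d      ≡⟨ sym (%-distribˡ-+ m n d) ⟩
  (m + n) % d              ∎

[m+k]%n≢m : ∀ {m k n} .{{_ : NonZero n}} → m < n → 0 < k → k < n → (m + k) % n ≢ m
[m+k]%n≢m {m} {k} {n} m<n 0<k k<n eq with m + k ℕ.<? n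
... | yes m+k<n = ℕₚ.<-irrefl (trans (sym eq) (m<n⇒m%n≡m m+k<n)) (ℕₚ.m<m+n m 0<k)
... | no m+k≮n = ℕₚ.<-irrefl wrapped below
  where
  n≤m+k : n ≤ m + k
  n≤m+k = ℕₚ.≮⇒≥ m+k≮n
  below : m + k ∸ n < m
  below = subst (m + k ∸ n <_) (ℕₚ.m+n∸n≡m m n) (ℕₚ.∸-monoˡ-< (ℕₚ.+-monoʳ-< m k<n) n≤m+k)
  wrapped : m + k ∸ n ≡ m
  wrapped = begin
    m + k ∸ n        ≡⟨ sym (m<n⇒m%n≡m (ℕₚ.<-trans below m<n)) ⟩
    (m + k ∸ n) % n  ≡⟨ m≤n⇒[n∸m]%m≡n%m n≤m+k ⟩
    (m + k) % n      ≡⟨ eq ⟩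
    m                ∎

module CyclicShift (p : ℕ) where

  n : ℕ
  n = suc p

  _⟳_ : Fin n → ℕ → Fin n
  i ⟳ zero  = i
  i ⟳ suc k = cycNext (i ⟳ k)

  toℕ-⟳ : ∀ i k → toℕ (i ⟳ k) ≡ (toℕ i + k) % n
  toℕ-⟳ i zero = begin
    toℕ i            ≡⟨ sym (m<n⇒m%n≡m (Finₚ.toℕ<n i)) ⟩
    toℕ i % n        ≡⟨ cong (_% n) (sym (ℕₚ.+-identityʳ (toℕ i))) ⟩
    (toℕ i + 0) % n  ∎
  toℕ-⟳ i (suc k) = begin
    toℕ (cycNext (i ⟳ k))      ≡⟨ Finₚ.toℕ-fromℕ< _ ⟩
    suc (toℕ (i ⟳ k)) % n      ≡⟨ cong (λ x → suc x % n) (toℕ-⟳ i k) ⟩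
    (1 + (toℕ i + k) % n) % n  ≡⟨ [m+n%d]%d≡[m+n]%d 1 (toℕ i + k) n ⟩
    suc (toℕ i + k) % n        ≡⟨ cong (_% n) (sym (ℕₚ.+-suc (toℕ i) k)) ⟩
    (toℕ i + suc k) % n        ∎

  ⟳-period : ∀ i → i ⟳ n ≡ i
  ⟳-period i = Finₚ.toℕ-injective (begin
    toℕ (i ⟳ n)      ≡⟨ toℕ-⟳ i n ⟩
    (toℕ i + n) % n  ≡⟨ [m+n]%n≡m%n (toℕ i) n ⟩
    toℕ i % n        ≡⟨ m<n⇒m%n≡m (Finₚ.toℕ<n i) ⟩
    toℕ i            ∎)

  ⟳-+ : ∀ i k l → (i ⟳ k) ⟳ l ≡ i ⟳ (k + l)
  ⟳-+ i k zero    = cong (i ⟳_) (sym (ℕₚ.+-identityʳ k))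
  ⟳-+ i k (suc l) = trans (cong cycNext (⟳-+ i k l)) (cong (i ⟳_) (sym (ℕₚ.+-suc k l)))

  ⟳-aperiodic : ∀ {i k} → 0 < k → k < n → i ⟳ k ≢ i
  ⟳-aperiodic {i} {k} 0<k k<n eq =
    [m+k]%n≢m (Finₚ.toℕ<n i) 0<k k<n (trans (sym (toℕ-⟳ i k)) (cong toℕ eq))

  prev : Fin n → Fin n
  prev i = i ⟳ p

  prev-cycNext : ∀ i → prev (cycNext i) ≡ i
  prev-cycNext i = trans (⟳-+ i 1 p) (⟳-period i)

  cycNext-injective : ∀ {i j} → cycNext i ≡ cycNext j → i ≡ j
  cycNext-injective {i} {j} eq = begin
    i                  ≡⟨ sym (prev-cycNext i) ⟩
    prev (cycNext i)   ≡⟨ cong prev eq ⟩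
    prev (cycNext j)   ≡⟨ prev-cycNext j ⟩
    j                  ∎

EndsMeet : {V : Set} → V × V → V × V → Set
EndsMeet (a , b) (c , d) = (a ≡ c) ⊎ (a ≡ d) ⊎ (b ≡ c) ⊎ (b ≡ d)

endsMeet-sym : ∀ {V : Set} {x y : V × V} → EndsMeet x y → EndsMeet y x
endsMeet-sym (inj₁ a≡c)                 = inj₁ (sym a≡c)
endsMeet-sym (inj₂ (inj₁ a≡d))          = inj₂ (inj₂ (inj₁ (sym a≡d)))
endsMeet-sym (inj₂ (inj₂ (inj₁ b≡c)))   = inj₂ (inj₁ (sym b≡c))
endsMeet-sym (inj₂ (inj₂ (inj₂ b≡d)))   = inj₂ (inj₂ (inj₂ (sym b≡d)))

is-just⇒≡just : ∀ {A : Set} {x : Maybe A} → Is-just x → ∃ λ a → x ≡ just a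
is-just⇒≡just (just {x = a} _) = a , refl

≢nothing⇒is-just : ∀ {A : Set} {x : Maybe A} → x ≢ nothing → Is-just x
≢nothing⇒is-just {x = just _}  _ = just tt
≢nothing⇒is-just {x = nothing} x≢nothing = ⊥-elim (x≢nothing refl)

module GraphColouring (G : Graph) where

  sharesEnd⇒endsMeet : ∀ e e' {x y} → ends G e ≡ x → ends G e' ≡ y → SharesEnd G e e' → EndsMeet x y
  sharesEnd⇒endsMeet e e' eq eq' s with ends G e | ends G e'
  ... | _ , _ | _ , _ with refl ← eq | refl ← eq' = s

  endsMeet⇒sharesEnd : ∀ e e' {x y} → ends G e ≡ x → ends G e' ≡ y → EndsMeet x y → SharesEnd G e e'
  endsMeet⇒sharesEnd e e' eq eq' m with ends G e | ends G e'
  ... | _ , _ | _ , _ with refl ← eq | refl ← eq' = m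

  adjacent-sym : ∀ {e e'} → Adjacent G e e' → Adjacent G e' e
  adjacent-sym {e} {e'} (e≢e' , s) =
    e≢e' ∘ sym , endsMeet⇒sharesEnd e' e refl refl (endsMeet-sym (sharesEnd⇒endsMeet e e' refl refl s))

  module _ {k : ℕ} where

    _[_≔_] : Colouring G k → Fin (nE G) → Fin k → Colouring G k
    col [ e ≔ c ] = update {G} col e c

    update-same : ∀ col e c → (col [ e ≔ c ]) e ≡ just c
    update-same col e c with e Fin.≟ e
    ... | yes _  = refl
    ... | no e≢e = ⊥-elim (e≢e refl)

    update-other : ∀ col {e e'} c → e' ≢ e → (col [ e ≔ c ]) e' ≡ col e'
    update-other col {e} {e'} c e'≢e with e' Fin.≟ e
    ... | yes e'≡e = ⊥-elim (e'≢e e'≡e)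
    ... | no _     = refl

    update-coloured : ∀ col e c → (col [ e ≔ c ]) e ≢ nothing
    update-coloured col e c h with () ← trans (sym (update-same col e c)) h

    update-nothing : ∀ col {e e'} c → (col [ e ≔ c ]) e' ≡ nothing → col e' ≡ nothing
    update-nothing col {e} {e'} c h with e' Fin.≟ e
    ... | yes _ with () ← h
    ... | no _  = h

    holes : ∀ {K} → (Fin K → Fin (nE G)) → Colouring G k → ℕ
    holes g col = count (λ x → Maybeₚ.≡-dec Fin._≟_ (col (g x)) nothing)

    holes-update : ∀ {K} {g : Fin K → Fin (nE G)} → (∀ {x y} → g x ≡ g y → x ≡ y) →
                   ∀ {col s} c → col (g s) ≡ nothing → holes g col ≡ suc (holes g (col [ g s ≔ c ]))
    holes-update {g = g} g-injective {col} {s} c hole =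
      trans (count-∖ open? hole) (cong suc (count-cong (open? ∖ s) _ after before))
      where
      open? : ∀ x → Dec (col (g x) ≡ nothing)
      open? x = Maybeₚ.≡-dec Fin._≟_ (col (g x)) nothing
      after : ∀ x → col (g x) ≡ nothing × x ≢ s → (col [ g s ≔ c ]) (g x) ≡ nothing
      after x (hole-x , x≢s) = trans (update-other col c (x≢s ∘ g-injective)) hole-x
      before : ∀ x → (col [ g s ≔ c ]) (g x) ≡ nothing → col (g x) ≡ nothing × x ≢ s
      before x hole-x = update-nothing col c hole-x , λ { refl → update-coloured col (g s) c hole-x }

    holes≡0 : ∀ {K} (g : Fin K → Fin (nE G)) {col} → holes g col ≡ 0 → ∀ x → col (g x) ≢ nothing
    holes≡0 g {col} = count≡0⇒¬ (λ x → Maybeₚ.≡-dec Fin._≟_ (col (g x)) nothing)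

    holes≡suc⇒∃ : ∀ {K} (g : Fin K → Fin (nE G)) {col h} → holes g col ≡ suc h → ∃ λ x → col (g x) ≡ nothing
    holes≡suc⇒∃ g {col} = count≡suc⇒∃ (λ x → Maybeₚ.≡-dec Fin._≟_ (col (g x)) nothing)

    Proper : Colouring G k → Set
    Proper col = ∀ {e e' c} → Adjacent G e e' → col e ≡ just c → col e' ≢ just c

    empty-proper : Proper (emptyColouring G k)
    empty-proper _ ()

    legal-proper : ∀ {col e c} → Proper col → Legal G k col e c → Proper (col [ e ≔ c ])
    legal-proper {col} {e} proper (_ , free) {e₁} {e₂} adj h₁ h₂ with e₁ Fin.≟ e | e₂ Fin.≟ e
    ... | yes refl | yes refl = proj₁ adj refl
    ... | yes refl | no _     with refl ← h₁ = free e₂ adj h₂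
    ... | no _     | yes refl with refl ← h₂ = free e₁ (adjacent-sym adj) h₁
    ... | no _     | no _     = proper adj h₁ h₂

    clique-¬makerWins : ∀ {m N col t} (f : Fin N → Fin (nE G)) → (∀ {i j} → i ≢ j → Adjacent G (f i) (f j)) →
                        k < N → Proper col → ¬ MakerWins G m k col t
    clique-¬makerWins {col = col} f clique k<N proper (done all) =
      let i , j , i<j , same = Finₚ.pigeonhole k<N (proj₁ ∘ colourOf)
      in proper (clique (Finₚ.<⇒≢ i<j)) (proj₂ (colourOf i)) (trans (proj₂ (colourOf j)) (cong just (sym same)))
      where
      colourOf : ∀ i → ∃ λ c → col (f i) ≡ just c
      colourOf i = is-just⇒≡just (all (f i))
    clique-¬makerWins f clique k<N proper (mMove e c legal win) =
      clique-¬makerWins f clique k<N (legal-proper proper legal) win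
    clique-¬makerWins f clique k<N proper (bMove (e , c , legal) win) =
      clique-¬makerWins f clique k<N (legal-proper proper legal) (win e c legal)

module WheelGraph (p : ℕ) where

  open CyclicShift p public

  W : Graph
  W = Wheel n

  open GraphColouring W public

  spoke : Fin n → Fin (n + n)
  spoke i = i ↑ˡ n

  rim : Fin n → Fin (n + n)
  rim l = n ↑ʳ l

  ends-spoke : ∀ i → ends W (spoke i) ≡ (zero , suc i)
  ends-spoke i rewrite Finₚ.splitAt-↑ˡ n i n = refl

  ends-rim : ∀ l → ends W (rim l) ≡ (suc l , suc (cycNext l))
  ends-rim l rewrite Finₚ.splitAt-↑ʳ n n l = refl

  data EdgeView : Fin (n + n) → Set where
    spokeEdge : ∀ i → EdgeView (spoke i)
    rimEdge   : ∀ l → EdgeView (rim l)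

  edgeView : ∀ e → EdgeView e
  edgeView e = subst EdgeView (Finₚ.join-splitAt n n e) (fromSplit (splitAt n e))
    where
    fromSplit : ∀ s → EdgeView (join n n s)
    fromSplit (inj₁ i) = spokeEdge i
    fromSplit (inj₂ l) = rimEdge l

  spoke-injective : ∀ {i j} → spoke i ≡ spoke j → i ≡ j
  spoke-injective {i} {j} = Finₚ.↑ˡ-injective n i j

  rim-injective : ∀ {k l} → rim k ≡ rim l → k ≡ l
  rim-injective {k} {l} = Finₚ.↑ʳ-injective n k l

  spoke≢rim : ∀ i l → spoke i ≢ rim l
  spoke≢rim i l eq
    with () ← trans (sym (Finₚ.splitAt-↑ˡ n i n)) (trans (cong (splitAt n) eq) (Finₚ.splitAt-↑ʳ n n l))

  Neighbours : Fin n → Fin n → Set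
  Neighbours a b = b ≡ cycNext a ⊎ a ≡ cycNext b

  neighbours? : ∀ a b → Dec (Neighbours a b)
  neighbours? a b with b Fin.≟ cycNext a | a Fin.≟ cycNext b
  ... | yes b≡a⁺ | _        = yes (inj₁ b≡a⁺)
  ... | no _     | yes a≡b⁺ = yes (inj₂ a≡b⁺)
  ... | no b≢a⁺  | no a≢b⁺  = no λ { (inj₁ b≡a⁺) → b≢a⁺ b≡a⁺ ; (inj₂ a≡b⁺) → a≢b⁺ a≡b⁺ }

  neighbours-triangle-free : 3 ≤ p → ∀ {a b c} → a ≢ b → a ≢ c → b ≢ c →
                             Neighbours a b → Neighbours a c → Neighbours b c → ⊥
  neighbours-triangle-free _   _   _   b≢c (inj₁ refl)  (inj₁ refl)  _            = b≢c refl
  neighbours-triangle-free _   _   _   b≢c (inj₂ a≡b⁺)  (inj₂ a≡c⁺)  _            =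
    b≢c (cycNext-injective (trans (sym a≡b⁺) a≡c⁺))
  neighbours-triangle-free 3≤p _   _   _   (inj₁ refl)  (inj₂ a≡c⁺)  (inj₁ refl)  =
    ⟳-aperiodic (s≤s z≤n) (s≤s 3≤p) (sym a≡c⁺)
  neighbours-triangle-free _   a≢b _   _   (inj₁ refl)  (inj₂ a≡c⁺)  (inj₂ b≡c⁺)  = a≢b (trans a≡c⁺ (sym b≡c⁺))
  neighbours-triangle-free _   a≢b _   _   (inj₂ _)     (inj₁ refl)  (inj₁ c≡b⁺)  = a≢b (cycNext-injective c≡b⁺)
  neighbours-triangle-free 3≤p _   _   _   (inj₂ a≡b⁺)  (inj₁ refl)  (inj₂ refl)  =
    ⟳-aperiodic (s≤s z≤n) (s≤s 3≤p) (sym a≡b⁺)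

  spokes-adjacent : ∀ {i j} → i ≢ j → Adjacent W (spoke i) (spoke j)
  spokes-adjacent {i} {j} i≢j =
    i≢j ∘ spoke-injective , endsMeet⇒sharesEnd (spoke i) (spoke j) (ends-spoke i) (ends-spoke j) (inj₁ refl)

  spoke-rim-adjacent : ∀ {i l} → Adjacent W (spoke i) (rim l) → i ≡ l ⊎ i ≡ cycNext l
  spoke-rim-adjacent {i} {l} (_ , s) with sharesEnd⇒endsMeet (spoke i) (rim l) (ends-spoke i) (ends-rim l) s
  ... | inj₁ ()
  ... | inj₂ (inj₁ ())
  ... | inj₂ (inj₂ (inj₁ i⁺≡l⁺))  = inj₁ (Finₚ.suc-injective i⁺≡l⁺)
  ... | inj₂ (inj₂ (inj₂ i⁺≡l⁺⁺)) = inj₂ (Finₚ.suc-injective i⁺≡l⁺⁺)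

  rims-adjacent : ∀ {k l} → Adjacent W (rim k) (rim l) → Neighbours k l
  rims-adjacent {k} {l} (rk≢rl , s) with sharesEnd⇒endsMeet (rim k) (rim l) (ends-rim k) (ends-rim l) s
  ... | inj₁ eq                 = ⊥-elim (rk≢rl (cong rim (Finₚ.suc-injective eq)))
  ... | inj₂ (inj₁ eq)          = inj₂ (Finₚ.suc-injective eq)
  ... | inj₂ (inj₂ (inj₁ eq))   = inj₁ (sym (Finₚ.suc-injective eq))
  ... | inj₂ (inj₂ (inj₂ eq))   = ⊥-elim (rk≢rl (cong rim (cycNext-injective (Finₚ.suc-injective eq))))

  fewer-colours-lose : ∀ {m k} → k < n → ¬ MakerHasWinningStrategy W m k
  fewer-colours-lose k<n = clique-¬makerWins spoke spokes-adjacent k<n empty-proper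

  module _ {k : ℕ} {col : Colouring W k} where

    spoke-legal : ∀ {j c} → col (spoke j) ≡ nothing → (∀ i → col (spoke i) ≢ just c) →
                  (∀ l → j ≡ l ⊎ j ≡ cycNext l → col (rim l) ≢ just c) → Legal W k col (spoke j) c
    spoke-legal {j} {c} uncoloured spokes-ok rims-ok = uncoloured , check
      where
      check : ∀ e → Adjacent W (spoke j) e → col e ≢ just c
      check e adj with edgeView e
      ... | spokeEdge i = spokes-ok i
      ... | rimEdge l   = rims-ok l (spoke-rim-adjacent adj)

    rimNeighbourhood : Fin n → Fin 4 → Maybe (Fin k)
    rimNeighbourhood l zero                   = col (spoke l)
    rimNeighbourhood l (suc zero)             = col (spoke (cycNext l))
    rimNeighbourhood l (suc (suc zero))       = col (rim (prev l))
    rimNeighbourhood l (suc (suc (suc zero))) = col (rim (cycNext l))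

    rim-legal : ∀ {l c} → col (rim l) ≡ nothing → Avoids (rimNeighbourhood l) c → Legal W k col (rim l) c
    rim-legal {l} {c} uncoloured avoids = uncoloured , check
      where
      check : ∀ e → Adjacent W (rim l) e → col e ≢ just c
      check e adj with edgeView e
      check _ adj | spokeEdge i with spoke-rim-adjacent (adjacent-sym adj)
      ... | inj₁ refl = avoids zero
      ... | inj₂ refl = avoids (suc zero)
      check _ adj | rimEdge l' with rims-adjacent adj
      ... | inj₁ refl  = avoids (suc (suc (suc zero)))
      ... | inj₂ l≡l'⁺ =
        subst (λ x → col (rim x) ≢ just c) (trans (cong prev l≡l'⁺) (prev-cycNext l')) (avoids (suc (suc zero)))

    rim-colourable : 5 ≤ k → ∀ {l} → col (rim l) ≡ nothing → ∃ λ c → Legal W k col (rim l) c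
    rim-colourable 5≤k {l} uncoloured =
      let t , avoids = pigeonhole-avoid (rimNeighbourhood l) ℕₚ.≤-refl (λ t → Fin.inject≤ t 5≤k)
                                        (Finₚ.inject≤-injective _ _ _ _)
      in Fin.inject≤ t 5≤k , rim-legal uncoloured avoids

    spokes-distinct : Proper col → ∀ {i j c} → col (spoke i) ≡ just c → col (spoke j) ≡ just c → i ≡ j
    spokes-distinct proper {i} {j} hi hj with i Fin.≟ j
    ... | yes i≡j = i≡j
    ... | no i≢j  = ⊥-elim (proper (spokes-adjacent i≢j) hi hj)

module WheelInvariants (p : ℕ) where

  open WheelGraph p public

  Col : Set
  Col = Colouring W n

  OpenSpoke : Col → Fin n → Set
  OpenSpoke col i = col (spoke i) ≡ nothing

  open? : ∀ col → Decidable (OpenSpoke col)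
  open? col i = Maybeₚ.≡-dec Fin._≟_ (col (spoke i)) nothing

  openSpokes : Col → ℕ
  openSpokes = holes spoke

  uncoloured : Col → ℕ
  uncoloured = holes (λ e → e)

  SpokeFree : Col → Fin n → Set
  SpokeFree col = Avoids (col ∘ spoke)

  -- A colour that is on no spoke is then legal on every open spoke.
  Guarded : Col → Set
  Guarded col = ∀ l c → col (rim l) ≡ just c → SpokeFree col c → ¬ OpenSpoke col l × ¬ OpenSpoke col (cycNext l)

  -- What Maker needs to repair a guarded position after Breaker colours an uncoloured rim edge.
  Spare : Col → Set
  Spare col = ∀ l → col (rim l) ≡ nothing → ∃ λ j → OpenSpoke col j × j ≢ l × j ≢ cycNext l

  module _ {col : Col} where

    rim-move-spoke : ∀ {l c} i → (col [ rim l ≔ c ]) (spoke i) ≡ col (spoke i)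
    rim-move-spoke {l} {c} i = update-other col c (spoke≢rim i l)

    spoke-move-rim : ∀ {j c} l → (col [ spoke j ≔ c ]) (rim l) ≡ col (rim l)
    spoke-move-rim {j} {c} l = update-other col c (spoke≢rim j l ∘ sym)

    other-rim : ∀ {l l' c} → l' ≢ l → (col [ rim l ≔ c ]) (rim l') ≡ col (rim l')
    other-rim {c = c} l'≢l = update-other col c (l'≢l ∘ rim-injective)

    closed-after : ∀ {e c a b} → ¬ OpenSpoke col a × ¬ OpenSpoke col b →
                   ¬ OpenSpoke (col [ e ≔ c ]) a × ¬ OpenSpoke (col [ e ≔ c ]) b
    closed-after {c = c} (closed-a , closed-b) = closed-a ∘ update-nothing col c , closed-b ∘ update-nothing col c

    spokeFree-before-rim : ∀ {l c d} → SpokeFree (col [ rim l ≔ c ]) d → SpokeFree col d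
    spokeFree-before-rim free i = free i ∘ trans (rim-move-spoke i)

    spokeFree-before-spoke : ∀ {j c d} → OpenSpoke col j → SpokeFree (col [ spoke j ≔ c ]) d → SpokeFree col d
    spokeFree-before-spoke {j} {c} open-j free i hi with i Fin.≟ j
    ... | yes refl with () ← trans (sym open-j) hi
    ... | no i≢j = free i (trans (update-other col c (i≢j ∘ spoke-injective)) hi)

    openSpokes-spoke : ∀ {s} c → OpenSpoke col s → openSpokes col ≡ suc (openSpokes (col [ spoke s ≔ c ]))
    openSpokes-spoke c = holes-update spoke-injective {col} c

    openSpokes-rim : ∀ {l c} → openSpokes (col [ rim l ≔ c ]) ≡ openSpokes col
    openSpokes-rim {l} {c} =
      count-cong (open? (col [ rim l ≔ c ])) (open? col) (λ i → trans (sym (rim-move-spoke i))) (λ i → trans (rim-move-spoke i))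

    uncoloured-move : ∀ {e} c → col e ≡ nothing → uncoloured col ≡ suc (uncoloured (col [ e ≔ c ]))
    uncoloured-move c = holes-update (λ eq → eq) {col} c

    guarded-spoke-legal : Guarded col → ∀ {j c} → OpenSpoke col j → SpokeFree col c → Legal W n col (spoke j) c
    guarded-spoke-legal guarded {j} {c} open-j free = spoke-legal open-j free rims-ok
      where
      rims-ok : ∀ l → j ≡ l ⊎ j ≡ cycNext l → col (rim l) ≢ just c
      rims-ok l (inj₁ refl) hl = proj₁ (guarded _ _ hl free) open-j
      rims-ok l (inj₂ refl) hl = proj₂ (guarded _ _ hl free) open-j

    guarded-spoke : Guarded col → ∀ {j c} → OpenSpoke col j → Guarded (col [ spoke j ≔ c ])
    guarded-spoke guarded {j} {c} open-j l d hl free =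
      closed-after (guarded _ _ (trans (sym (spoke-move-rim {j} {c} l)) hl) (spokeFree-before-spoke open-j free))

    guarded-rim : Guarded col → ∀ {l c} → (SpokeFree col c → ¬ OpenSpoke col l × ¬ OpenSpoke col (cycNext l)) →
                  Guarded (col [ rim l ≔ c ])
    guarded-rim guarded {l} {c} new-rim-ok l' d hl' free with l' Fin.≟ l
    ... | yes refl with refl ← trans (sym (update-same col (rim l) c)) hl' =
      closed-after (new-rim-ok (spokeFree-before-rim free))
    ... | no l'≢l = closed-after (guarded _ _ (trans (sym (other-rim l'≢l)) hl') (spokeFree-before-rim free))

    guarded-rim-used : Guarded col → ∀ {l c} → ¬ SpokeFree col c → Guarded (col [ rim l ≔ c ])
    guarded-rim-used guarded used = guarded-rim guarded (⊥-elim ∘ used)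

    guarded-rim-closed : Guarded col → ∀ {l c} → ¬ OpenSpoke col l → ¬ OpenSpoke col (cycNext l) →
                         Guarded (col [ rim l ≔ c ])
    guarded-rim-closed guarded closed-l closed-l⁺ = guarded-rim guarded (λ _ → closed-l , closed-l⁺)

    spare-rim : Spare col → ∀ {l c} → Spare (col [ rim l ≔ c ])
    spare-rim spare {l} {c} l' hl' with l' Fin.≟ l
    ... | yes refl with () ← trans (sym (update-same col (rim l) c)) hl'
    ... | no l'≢l = let j , open-j , avoids-l' = spare _ (trans (sym (other-rim l'≢l)) hl')
                    in j , trans (rim-move-spoke j) open-j , avoids-l'

    spare-apart : ∀ {y z} → OpenSpoke col y → OpenSpoke col z → y ≢ z → ¬ Neighbours y z → Spare col
    spare-apart {y} {z} open-y open-z y≢z apart l _ with y Fin.≟ l | y Fin.≟ cycNext l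
    ... | no y≢l   | no y≢l⁺ = y , open-y , y≢l , y≢l⁺
    ... | yes refl | _        = z , open-z , y≢z ∘ sym , apart ∘ inj₁
    ... | no _     | yes refl = z , open-z , apart ∘ inj₂ ∘ cong cycNext ∘ sym , y≢z ∘ sym

    spare-three : ∀ {a b c} → OpenSpoke col a → OpenSpoke col b → OpenSpoke col c →
                  a ≢ b → a ≢ c → b ≢ c → Spare col
    spare-three {a} {b} {c} open-a open-b open-c a≢b a≢c b≢c l _ with a Fin.≟ l | a Fin.≟ cycNext l
    ... | no a≢l | no a≢l⁺ = a , open-a , a≢l , a≢l⁺
    ... | yes refl | _ with b Fin.≟ cycNext a
    ...   | no b≢a⁺  = b , open-b , a≢b ∘ sym , b≢a⁺
    ...   | yes refl = c , open-c , a≢c ∘ sym , b≢c ∘ sym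
    spare-three {a} {b} {c} open-a open-b open-c a≢b a≢c b≢c l _ | no _ | yes refl with b Fin.≟ l
    ...   | no b≢l   = b , open-b , b≢l , a≢b ∘ sym
    ...   | yes refl = c , open-c , b≢c ∘ sym , a≢c ∘ sym

    spare-beside : 2 ≤ p → ∀ {x} → OpenSpoke col x → OpenSpoke col (cycNext x) → col (rim x) ≢ nothing → Spare col
    spare-beside 2≤p {x} open-x open-x⁺ coloured l hl with x Fin.≟ l | x Fin.≟ cycNext l
    ... | yes refl | _        = ⊥-elim (coloured hl)
    ... | no x≢l   | no x≢l⁺  = x , open-x , x≢l , x≢l⁺
    ... | no _     | yes refl = cycNext x , open-x⁺ , ⟳-aperiodic (s≤s z≤n) (s≤s 2≤p) ,
                                 ⟳-aperiodic (s≤s z≤n) (s≤s (ℕₚ.≤-trans (s≤s z≤n) 2≤p))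

    repair-legal : Guarded col → ∀ {l c j} → SpokeFree col c → OpenSpoke col j → j ≢ l → j ≢ cycNext l →
                   Legal W n (col [ rim l ≔ c ]) (spoke j) c
    repair-legal guarded {l} {c} {j} free open-j j≢l j≢l⁺ =
      spoke-legal (trans (rim-move-spoke j) open-j) (λ i → free i ∘ trans (sym (rim-move-spoke i))) rims-ok
      where
      rims-ok : ∀ l' → j ≡ l' ⊎ j ≡ cycNext l' → (col [ rim l ≔ c ]) (rim l') ≢ just c
      rims-ok l' ends hl' with l' Fin.≟ l | ends
      ... | yes refl | inj₁ j≡l  = j≢l j≡l
      ... | yes refl | inj₂ j≡l⁺ = j≢l⁺ j≡l⁺
      ... | no l'≢l  | inj₁ refl = proj₁ (guarded _ _ (trans (sym (other-rim l'≢l)) hl') free) open-j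
      ... | no l'≢l  | inj₂ refl = proj₂ (guarded _ _ (trans (sym (other-rim l'≢l)) hl') free) open-j

    repair-guarded : Guarded col → ∀ {l c j} → SpokeFree col c → OpenSpoke col j →
                     Guarded ((col [ rim l ≔ c ]) [ spoke j ≔ c ])
    repair-guarded guarded {l} {c} {j} free open-j l' d hl' free₂ =
      let closed , closed⁺ = guarded _ _ hl'-before free-before
      in closed ∘ reopened , closed⁺ ∘ reopened
      where
      col₁ : Col
      col₁ = col [ rim l ≔ c ]
      reopened : ∀ {i} → OpenSpoke (col₁ [ spoke j ≔ c ]) i → OpenSpoke col i
      reopened {i} = update-nothing col {rim l} {spoke i} c ∘ update-nothing col₁ {spoke j} {spoke i} c
      c≢d : c ≢ d
      c≢d refl = free₂ j (update-same col₁ (spoke j) c)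
      hl'₁ : col₁ (rim l') ≡ just d
      hl'₁ = trans (sym (update-other col₁ c (spoke≢rim j l' ∘ sym))) hl'
      l'≢l : l' ≢ l
      l'≢l refl = c≢d (Maybeₚ.just-injective (trans (sym (update-same col (rim l) c)) hl'₁))
      hl'-before : col (rim l') ≡ just d
      hl'-before = trans (sym (other-rim l'≢l)) hl'₁
      free-before : SpokeFree col d
      free-before i hi with i Fin.≟ j
      ... | yes refl with () ← trans (sym open-j) hi
      ... | no i≢j = free₂ i (trans (update-other col₁ c (i≢j ∘ spoke-injective)) (trans (rim-move-spoke i) hi))

    open-after-spoke : ∀ {s c y} → y ≢ s → OpenSpoke col y → OpenSpoke (col [ spoke s ≔ c ]) y
    open-after-spoke {c = c} y≢s = trans (update-other col c (y≢s ∘ spoke-injective))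

    uncoloured-decreases : ∀ {e c} → col e ≡ nothing → uncoloured (col [ e ≔ c ]) < uncoloured col
    uncoloured-decreases {c = c} hole = ℕₚ.≤-reflexive (sym (uncoloured-move c hole))

    colour-open-spoke : Guarded col → ∀ {s} → OpenSpoke col s →
                        ∃ λ c → Legal W n col (spoke s) c × Guarded (col [ spoke s ≔ c ]) ×
                                openSpokes col ≡ suc (openSpokes (col [ spoke s ≔ c ]))
    colour-open-spoke guarded open-s =
      let c , free = unused-colour (col ∘ spoke) open-s
      in c , guarded-spoke-legal guarded open-s free , guarded-spoke guarded open-s , openSpokes-spoke c open-s

module MakerStrategy (p mm : ℕ) (4≤p : 4 ≤ p) where

  open WheelInvariants p public

  m : ℕ
  m = suc (suc mm)

  MW : Col → Turn → Set
  MW = MakerWins W m n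

  -- Maker's turn state `maker 0` is never reached.
  data Live : Turn → Set where
    makerLive   : ∀ r → Live (maker (suc r))
    breakerLive : Live breaker

  live-afterMaker : ∀ r → Live (afterMaker r)
  live-afterMaker zero    = breakerLive
  live-afterMaker (suc r) = makerLive r

  all-coloured : ∀ {col} → uncoloured col ≡ 0 → AllColoured W n col
  all-coloured {col} eq e = ≢nothing⇒is-just (holes≡0 (λ e → e) {col} eq e)

  all-spokes-coloured : ∀ {col} → openSpokes col ≡ 0 → ∀ i → ¬ OpenSpoke col i
  all-spokes-coloured {col} = holes≡0 spoke {col}

  endgame : ∀ N {col t} → uncoloured col ≡ N → (∀ i → ¬ OpenSpoke col i) → Live t → MW col t
  endgame zero    eq _ _ = done (all-coloured eq)
  endgame (suc N) {col} {t} eq spokes-coloured live =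
    let e , hole = holes≡suc⇒∃ (λ e → e) {col} eq in play (edgeView e) hole live
    where
    continue : ∀ {e c t} → Legal W n col e c → Live t → MW (col [ e ≔ c ]) t
    continue {e} {c} legal =
      endgame N (ℕₚ.suc-injective (trans (sym (uncoloured-move {col} c (proj₁ legal))) eq))
                (λ i → spokes-coloured i ∘ update-nothing col {e} {spoke i} c)
    play : ∀ {e} → EdgeView e → col e ≡ nothing → Live t → MW col t
    play (spokeEdge i) hole _ = ⊥-elim (spokes-coloured i hole)
    play (rimEdge l) hole (makerLive r) =
      let c , legal = rim-colourable {col = col} (s≤s 4≤p) hole
      in mMove (rim l) c legal (continue legal (live-afterMaker r))
    play (rimEdge l) hole breakerLive =
      let c , legal = rim-colourable {col = col} (s≤s 4≤p) hole
      in bMove (rim l , c , legal) (λ _ _ legal → continue legal (makerLive (suc mm)))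

  2≤p : 2 ≤ p
  2≤p = ℕₚ.≤-trans (s≤s (s≤s z≤n)) 4≤p

  cycNext-moves : ∀ {x} → x ≢ cycNext x
  cycNext-moves = ⟳-aperiodic (s≤s z≤n) (s≤s (ℕₚ.≤-trans (s≤s z≤n) 2≤p)) ∘ sym

  -- With u open spokes and r moves left in her turn, Maker can end the turn in a Handover position: on five
  -- spokes by colouring them all (u ≤ r) or by leaving two that are not neighbours (u ≡ r + 2).
  Manageable : ℕ → ℕ → Set
  Manageable u r = 5 ≤ p ⊎ u ≤ r ⊎ u ≡ r + 2

  manageable-pred : ∀ {u r} → Manageable (suc u) (suc r) → Manageable u r
  manageable-pred (inj₁ 5≤p)              = inj₁ 5≤p
  manageable-pred (inj₂ (inj₁ (s≤s u≤r))) = inj₂ (inj₁ u≤r)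
  manageable-pred (inj₂ (inj₂ refl))      = inj₂ (inj₂ refl)

  Handover : Col → Set
  Handover col = Guarded col × (openSpokes col ≡ 0 ⊎ Spare col) × (5 ≤ p ⊎ openSpokes col ≤ 2)

  ClosingMove : Col → Set
  ClosingMove col = ∃₂ λ e c → Legal W n col e c × Handover (col [ e ≔ c ])

  OnlyOpen : Col → Fin n → Fin n → Set
  OnlyOpen col a b = ∀ i → OpenSpoke col i → i ≡ a ⊎ i ≡ b

  module _ {col : Col} (proper : Proper col) (guarded : Guarded col) where

    only-open : ∀ {a b} → count ((open? col ∖ a) ∖ b) ≡ 0 → OnlyOpen col a b
    only-open {a} {b} none i open-i with i Fin.≟ a | i Fin.≟ b
    ... | yes i≡a | _        = inj₁ i≡a
    ... | no _    | yes i≡b  = inj₂ i≡b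
    ... | no i≢a  | no i≢b   = ⊥-elim (count≡0⇒¬ ((open? col ∖ a) ∖ b) none i ((open-i , i≢a) , i≢b))

    -- The n − 2 coloured spokes carry distinct colours, so fewer than n − 2 forbidden colours miss one of them.
    used-colour-avoiding : ∀ {a b} → a ≢ b → OnlyOpen col a b → ∀ {j} → j < n ∸ 2 → (forb : Fin j → Maybe (Fin n)) →
                           ∃ λ γ → ¬ SpokeFree col γ × Avoids forb γ
    used-colour-avoiding {a} {b} a≢b only j<n∸2 forb with avoid-two a b a≢b
    ... | g , g-injective , g-misses =
      let t , avoids = pigeonhole-avoid forb j<n∸2 (proj₁ ∘ colourAt) colourAt-injective
      in proj₁ (colourAt t) , (λ free → free (g t) (proj₂ (colourAt t))) , avoids
      where
      coloured : ∀ t → col (spoke (g t)) ≢ nothing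
      coloured t open-gt with only (g t) open-gt
      ... | inj₁ gt≡a = proj₁ (g-misses t) gt≡a
      ... | inj₂ gt≡b = proj₂ (g-misses t) gt≡b
      colourAt : ∀ t → ∃ λ γ → col (spoke (g t)) ≡ just γ
      colourAt t = is-just⇒≡just (≢nothing⇒is-just (coloured t))
      colourAt-injective : ∀ {s t} → proj₁ (colourAt s) ≡ proj₁ (colourAt t) → s ≡ t
      colourAt-injective {s} {t} eq =
        g-injective (spokes-distinct proper (proj₂ (colourAt s)) (trans (proj₂ (colourAt t)) (cong just (sym eq))))

    used-rim-move : 5 ≤ p → ∀ {a b l} → a ≢ b → OnlyOpen col a b → col (rim l) ≡ nothing →
                    ∀ t → rimNeighbourhood {col = col} l t ≡ nothing →
                    ∃ λ γ → Legal W n col (rim l) γ × ¬ SpokeFree col γ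
    used-rim-move 5≤p {l = l} a≢b only hole t end-open =
      let γ , used , avoids =
            used-colour-avoiding a≢b only (ℕₚ.∸-monoˡ-≤ 2 (s≤s 5≤p)) (rimNeighbourhood l ∘ punchIn t)
      in γ , rim-legal hole (avoids-punchIn (rimNeighbourhood l) {t} end-open avoids) , used

    closing-one : openSpokes col ≡ 1 → ClosingMove col
    closing-one one =
      let s , open-s = holes≡suc⇒∃ spoke {col} one
          γ , legal , guarded′ , drop = colour-open-spoke guarded open-s
          none = ℕₚ.suc-injective (trans (sym drop) one)
      in spoke s , γ , legal , guarded′ , inj₁ none , inj₂ (subst (_≤ 2) (sym none) z≤n)

    colour-third : ∀ {s y z} → OpenSpoke col s → OpenSpoke col y → OpenSpoke col z →
                   y ≢ s → z ≢ s → y ≢ z → ¬ Neighbours y z → openSpokes col ≡ 3 → ClosingMove col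
    colour-third {s} open-s open-y open-z y≢s z≢s y≢z apart three =
      let γ , legal , guarded′ , drop = colour-open-spoke guarded open-s
      in spoke s , γ , legal , guarded′ ,
         inj₂ (spare-apart {col = col [ spoke s ≔ γ ]} (open-after-spoke y≢s open-y) (open-after-spoke z≢s open-z)
                           y≢z apart) ,
         inj₂ (ℕₚ.≤-reflexive (ℕₚ.suc-injective (trans (sym drop) three)))

    closing-three : openSpokes col ≡ 3 → ClosingMove col
    closing-three three with count-pick (open? col) three
    ... | a , open-a , two with count-pick (open? col ∖ a) two
    ... | b , (open-b , b≢a) , one with count≡suc⇒∃ ((open? col ∖ a) ∖ b) one
    ... | c , ((open-c , c≢a) , c≢b) with neighbours? a b | neighbours? a c | neighbours? b c
    ... | no a≁b  | _       | _       = colour-third open-c open-a open-b (c≢a ∘ sym) (c≢b ∘ sym) (b≢a ∘ sym) a≁b three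
    ... | yes _   | no a≁c  | _       = colour-third open-b open-a open-c (b≢a ∘ sym) c≢b (c≢a ∘ sym) a≁c three
    ... | yes _   | yes _   | no b≁c  = colour-third open-a open-b open-c b≢a c≢a (c≢b ∘ sym) b≁c three
    ... | yes a∼b | yes a∼c | yes b∼c =
      ⊥-elim (neighbours-triangle-free (ℕₚ.≤-trans (ℕₚ.n≤1+n 3) 4≤p) (b≢a ∘ sym) (c≢a ∘ sym) (c≢b ∘ sym)
                                       a∼b a∼c b∼c)

    closing-many : 5 ≤ p → ∀ {x} → openSpokes col ≡ suc (suc (suc (suc x))) → ClosingMove col
    closing-many 5≤p four with count-pick (open? col) four
    ... | a , open-a , three with count-pick (open? col ∖ a) three
    ... | b , (open-b , b≢a) , two with count-pick ((open? col ∖ a) ∖ b) two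
    ... | c , ((open-c , c≢a) , c≢b) , one with count≡suc⇒∃ (((open? col ∖ a) ∖ b) ∖ c) one
    ... | d , (((open-d , d≢a) , d≢b) , d≢c) =
      let γ , legal , guarded′ , _ = colour-open-spoke guarded open-a
      in spoke a , γ , legal , guarded′ ,
         inj₂ (spare-three {col = col [ spoke a ≔ γ ]} (open-after-spoke b≢a open-b) (open-after-spoke c≢a open-c)
                           (open-after-spoke d≢a open-d) (c≢b ∘ sym) (d≢b ∘ sym) (d≢c ∘ sym)) ,
         inj₁ 5≤p

    closing-spare : 5 ≤ p → Spare col → ∀ {a b} → a ≢ b → OpenSpoke col a → OnlyOpen col a b → ClosingMove col
    closing-spare 5≤p spare {a} a≢b open-a only
      with Finₚ.any? (λ l → Maybeₚ.≡-dec Fin._≟_ (col (rim l)) nothing)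
    ... | no rims-coloured =
      let γ , legal , guarded′ , _ = colour-open-spoke guarded open-a
      in spoke a , γ , legal , guarded′ ,
         inj₂ (λ l hole → ⊥-elim (rims-coloured (l , trans (sym (spoke-move-rim {col} {a} {γ} l)) hole))) ,
         inj₁ 5≤p
    ... | yes (l , hole) with open? col l | open? col (cycNext l)
    ...   | yes open-l | _ =
      let γ , legal , used = used-rim-move 5≤p a≢b only hole zero open-l
      in rim l , γ , legal , guarded-rim-used guarded used , inj₂ (spare-rim spare) , inj₁ 5≤p
    ...   | no _ | yes open-l⁺ =
      let γ , legal , used = used-rim-move 5≤p a≢b only hole (suc zero) open-l⁺
      in rim l , γ , legal , guarded-rim-used guarded used , inj₂ (spare-rim spare) , inj₁ 5≤p
    ...   | no closed | no closed⁺ =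
      let γ , legal = rim-colourable (s≤s 4≤p) hole
      in rim l , γ , legal , guarded-rim-closed guarded closed closed⁺ , inj₂ (spare-rim spare) , inj₁ 5≤p

    closing-beside : 5 ≤ p → ∀ {x} → OpenSpoke col x → OpenSpoke col (cycNext x) → OnlyOpen col x (cycNext x) →
                     ClosingMove col
    closing-beside 5≤p {x} open-x open-x⁺ only with Maybeₚ.≡-dec Fin._≟_ (col (rim x)) nothing
    ... | no coloured = closing-spare 5≤p (spare-beside {col} 2≤p open-x open-x⁺ coloured) cycNext-moves open-x only
    ... | yes hole =
      let γ , legal , used = used-rim-move 5≤p cycNext-moves only hole zero open-x
      in rim x , γ , legal , guarded-rim-used guarded used ,
         inj₂ (spare-beside {col = col [ rim x ≔ γ ]} 2≤p (trans (rim-move-spoke x) open-x)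
                            (trans (rim-move-spoke (cycNext x)) open-x⁺) (update-coloured col (rim x) γ)) ,
         inj₁ 5≤p

    closing-two : 5 ≤ p → openSpokes col ≡ 2 → ClosingMove col
    closing-two 5≤p two with count-pick (open? col) two
    ... | a , open-a , one with count-pick (open? col ∖ a) one
    ... | b , (open-b , b≢a) , none with neighbours? a b
    ...   | no a≁b          =
      closing-spare 5≤p (spare-apart {col} open-a open-b (b≢a ∘ sym) a≁b) (b≢a ∘ sym) open-a (only-open none)
    ...   | yes (inj₁ refl) = closing-beside 5≤p open-a open-b (only-open none)
    ...   | yes (inj₂ refl) = closing-beside 5≤p open-b open-a (λ i → Sum.swap ∘ only-open none i)

    closing-move : ∀ {u} → openSpokes col ≡ suc u → Manageable (suc u) 1 → ClosingMove col
    closing-move {zero}                   one  _                         = closing-one one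
    closing-move {suc zero}               two  (inj₁ 5≤p)                = closing-two 5≤p two
    closing-move {suc zero}               _    (inj₂ (inj₁ (s≤s ())))
    closing-move {suc zero}               _    (inj₂ (inj₂ ()))
    closing-move {suc (suc zero)}         three _                        = closing-three three
    closing-move {suc (suc (suc x))}      many (inj₁ 5≤p)                = closing-many 5≤p many
    closing-move {suc (suc (suc x))}      _    (inj₂ (inj₁ (s≤s ())))
    closing-move {suc (suc (suc x))}      _    (inj₂ (inj₂ ()))

  fuel-step : ∀ {N col} e c → uncoloured col ≤ suc N → col e ≡ nothing → uncoloured (col [ e ≔ c ]) ≤ N
  fuel-step {col = col} e c fuel hole = ℕ.s≤s⁻¹ (ℕₚ.<-≤-trans (uncoloured-decreases {col} {e} {c} hole) fuel)

  within-two : ∀ {v} → 5 ≤ p ⊎ v ≤ 2 → Manageable v m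
  within-two = Sum.map₂ (λ v≤2 → inj₁ (ℕₚ.≤-trans v≤2 (s≤s (s≤s z≤n))))

  handover-rim : ∀ {col l c} → Handover col → ¬ OpenSpoke col l → ¬ OpenSpoke col (cycNext l) →
                 Handover (col [ rim l ≔ c ])
  handover-rim {col} {l} {c} (guarded , spare? , few) closed closed⁺ =
    guarded-rim-closed guarded closed closed⁺ , spare-after spare? ,
    Sum.map₂ (subst (_≤ 2) (sym (openSpokes-rim {col}))) few
    where
    spare-after : openSpokes col ≡ 0 ⊎ Spare col →
                  openSpokes (col [ rim l ≔ c ]) ≡ 0 ⊎ Spare (col [ rim l ≔ c ])
    spare-after (inj₁ none)  = inj₁ (trans (openSpokes-rim {col}) none)
    spare-after (inj₂ spare) = inj₂ (spare-rim spare)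

  mutual
    makerTurn : ∀ N {col} r → uncoloured col ≤ N → Proper col → Guarded col →
                Manageable (openSpokes col) (suc r) → MW col (maker (suc r))
    makerTurn zero {col} _ fuel _ _ _ = done (all-coloured {col} (ℕₚ.n≤0⇒n≡0 fuel))
    makerTurn (suc N) {col} r fuel proper guarded manageable with openSpokes col in open-count | r
    ... | zero  | r′     = endgame _ refl (all-spokes-coloured {col} open-count) (makerLive r′)
    ... | suc u | suc r′ =
      let s , open-s = holes≡suc⇒∃ spoke {col} open-count
          γ , legal , guarded′ , drop = colour-open-spoke guarded open-s
      in mMove (spoke s) γ legal
           (makerTurn N r′ (fuel-step (spoke s) γ fuel open-s) (legal-proper proper legal) guarded′
              (subst (λ v → Manageable v (suc r′)) (ℕₚ.suc-injective (trans (sym open-count) drop))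
                     (manageable-pred manageable)))
    ... | suc u | zero   =
      let e , γ , legal , handover = closing-move proper guarded open-count manageable
      in mMove e γ legal (breakerTurn N (fuel-step e γ fuel (proj₁ legal)) (legal-proper proper legal) handover)

    breakerTurn : ∀ N {col} → uncoloured col ≤ N → Proper col → Handover col → MW col breaker
    breakerTurn zero {col} fuel _ _ = done (all-coloured {col} (ℕₚ.n≤0⇒n≡0 fuel))
    breakerTurn (suc N) {col} fuel proper (guarded , spare? , few) with openSpokes col in open-count
    ... | zero  = endgame _ refl (all-spokes-coloured {col} open-count) breakerLive
    ... | suc u =
      let s , open-s = holes≡suc⇒∃ spoke {col} open-count
          γ , free = unused-colour (col ∘ spoke) open-s
      in bMove (spoke s , γ , guarded-spoke-legal guarded open-s free) reply
      where
      spare : Spare col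
      spare = Sum.fromInj₂ (λ ()) spare?
      reply : ∀ e γ → Legal W n col e γ → MW (col [ e ≔ γ ]) (maker m)
      reply e γ legal with edgeView e
      ... | spokeEdge j =
        let drop = ℕₚ.suc-injective (trans (sym open-count) (openSpokes-spoke {col} γ (proj₁ legal)))
        in makerTurn N (suc mm) (fuel-step e γ fuel (proj₁ legal)) (legal-proper proper legal)
                     (guarded-spoke guarded (proj₁ legal))
                     (within-two (Sum.map₂ (subst (_≤ 2) drop ∘ ℕₚ.≤-trans (ℕₚ.n≤1+n u)) few))
      ... | rimEdge l =
        answerRim N (fuel-step e γ fuel (proj₁ legal)) proper guarded spare legal
                  (subst (λ v → Manageable v m) (sym open-count) (within-two few))

    -- If Breaker's colour is on no spoke, Maker plays it on a spare spoke at once, after which it is on a spoke.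
    answerRim : ∀ N {col l γ} → uncoloured (col [ rim l ≔ γ ]) ≤ N → Proper col → Guarded col → Spare col →
                Legal W n col (rim l) γ → Manageable (openSpokes col) m → MW (col [ rim l ≔ γ ]) (maker m)
    answerRim N {col} {l} {γ} fuel proper guarded spare legal manageable with avoids? (col ∘ spoke) γ
    ... | no used =
      makerTurn N (suc mm) fuel (legal-proper proper legal) (guarded-rim-used guarded used)
                (subst (λ v → Manageable v m) (sym (openSpokes-rim {col})) manageable)
    ... | yes free =
      let j , open-j , j≢l , j≢l⁺ = spare _ (proj₁ legal)
          col₁ = col [ rim l ≔ γ ]
          legal₂ = repair-legal guarded free open-j j≢l j≢l⁺
          drop = trans (sym (openSpokes-rim {col})) (openSpokes-spoke {col₁} {j} γ (proj₁ legal₂))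
      in mMove (spoke j) γ legal₂
           (makerTurn N mm
                      (ℕₚ.<⇒≤ (ℕₚ.<-≤-trans (uncoloured-decreases {col₁} {spoke j} {γ} (proj₁ legal₂)) fuel))
                      (legal-proper (legal-proper proper legal) legal₂) (repair-guarded guarded {l} {γ} {j} free open-j)
                      (manageable-pred (subst (λ v → Manageable v m) drop manageable)))

  maker-wins : Manageable (openSpokes (emptyColouring W n)) m → MakerHasWinningStrategy W m n
  maker-wins = makerTurn _ (suc mm) ℕₚ.≤-refl empty-proper (λ _ _ ())

  spoke-then-rim : ∀ {col} → Proper col → Guarded col → ∀ {s y z f} → OpenSpoke col s → OpenSpoke col y →
                   OpenSpoke col z → y ≢ s → z ≢ s → y ≢ z → ¬ Neighbours y z → openSpokes col ≡ 3 →
                   col (rim f) ≡ nothing →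
                   (∀ γ → ¬ OpenSpoke (col [ spoke s ≔ γ ]) f × ¬ OpenSpoke (col [ spoke s ≔ γ ]) (cycNext f)) →
                   MW col (maker 2)
  spoke-then-rim {col} proper guarded {s} {f = f} open-s open-y open-z y≢s z≢s y≢z apart three hole ends-closed =
    let e , γ , legal , handover = colour-third proper guarded open-s open-y open-z y≢s z≢s y≢z apart three
        δ , legal′ =
          rim-colourable {col = col [ spoke s ≔ γ ]} (s≤s 4≤p) (trans (spoke-move-rim {col} {s} {γ} f) hole)
        closed , closed⁺ = ends-closed γ
    in mMove e γ legal (mMove (rim f) δ legal′
         (breakerTurn _ ℕₚ.≤-refl (legal-proper (legal-proper proper legal) legal′)
                      (handover-rim handover closed closed⁺)))

-- On five spokes the empty position is not Manageable for m = 2 and m = 4. With two moves Maker opens by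
-- putting one colour on spoke 0 and rim edge 2, leaving four open spokes, any three of which are spare.
module FiveSpokesTwoMoves where

  open MakerStrategy 4 0 ℕₚ.≤-refl

  module _ (γ₀ : Fin n) (legal₀ : Legal W n (emptyColouring W n) (spoke (# 0)) γ₀)
           (guarded₁ : Guarded (emptyColouring W n [ spoke (# 0) ≔ γ₀ ])) where

    col₁ col₂ : Col
    col₁ = emptyColouring W n [ spoke (# 0) ≔ γ₀ ]
    col₂ = col₁ [ rim (# 2) ≔ γ₀ ]

    legal₂ : Legal W n col₁ (rim (# 2)) γ₀
    legal₂ = rim-legal refl λ { zero () ; (suc zero) () ; (suc (suc zero)) () ; (suc (suc (suc zero))) () }

    proper₂ : Proper col₂
    proper₂ = legal-proper (legal-proper empty-proper legal₀) legal₂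

    guarded₂ : Guarded col₂
    guarded₂ = guarded-rim-used guarded₁ (λ free → free (# 0) refl)

    spare₂ : Spare col₂
    spare₂ = spare-three {col₂} {# 1} {# 2} {# 3} refl refl refl (λ ()) (λ ()) (λ ())

    answer-spoke : ∀ j {γ} → Legal W n col₂ (spoke j) γ → MW (col₂ [ spoke j ≔ γ ]) (maker 2)
    answer-spoke zero (() , _)
    answer-spoke (suc zero) {γ} legal =
      spoke-then-rim (legal-proper proper₂ legal) (guarded-spoke guarded₂ {# 1} {γ} (proj₁ legal)) {# 3} {# 2} {# 4} {# 0}
                     refl refl refl (λ ()) (λ ()) (λ ()) (λ { (inj₁ ()) ; (inj₂ ()) }) refl refl
                     (λ _ → (λ ()) , (λ ()))
    answer-spoke (suc (suc zero)) {γ} legal =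
      spoke-then-rim (legal-proper proper₂ legal) (guarded-spoke guarded₂ {# 2} {γ} (proj₁ legal)) {# 4} {# 1} {# 3} {# 4}
                     refl refl refl (λ ()) (λ ()) (λ ()) (λ { (inj₁ ()) ; (inj₂ ()) }) refl refl
                     (λ _ → (λ ()) , (λ ()))
    answer-spoke (suc (suc (suc zero))) {γ} legal =
      spoke-then-rim (legal-proper proper₂ legal) (guarded-spoke guarded₂ {# 3} {γ} (proj₁ legal)) {# 1} {# 2} {# 4} {# 0}
                     refl refl refl (λ ()) (λ ()) (λ ()) (λ { (inj₁ ()) ; (inj₂ ()) }) refl refl
                     (λ _ → (λ ()) , (λ ()))
    answer-spoke (suc (suc (suc (suc zero)))) {γ} legal =
      spoke-then-rim (legal-proper proper₂ legal) (guarded-spoke guarded₂ {# 4} {γ} (proj₁ legal)) {# 2} {# 1} {# 3} {# 4}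
                     refl refl refl (λ ()) (λ ()) (λ ()) (λ { (inj₁ ()) ; (inj₂ ()) }) refl refl
                     (λ _ → (λ ()) , (λ ()))

    answer : ∀ {e γ} → EdgeView e → Legal W n col₂ e γ → MW (col₂ [ e ≔ γ ]) (maker 2)
    answer (spokeEdge j) = answer-spoke j
    answer (rimEdge l)   = λ legal → answerRim _ ℕₚ.≤-refl proper₂ guarded₂ spare₂ legal (inj₂ (inj₂ refl))

    after-opening : MW col₁ (maker 1)
    after-opening =
      let γ , legal , _ = colour-open-spoke guarded₂ {# 1} refl
      in mMove (rim (# 2)) γ₀ legal₂ (bMove (spoke (# 1) , γ , legal) (λ e _ legal → answer (edgeView e) legal))

  two-moves : MakerHasWinningStrategy W 2 n
  two-moves =
    let γ₀ , legal₀ , guarded₁ , _ = colour-open-spoke {emptyColouring W n} (λ _ _ ()) {# 0} refl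
    in mMove (spoke (# 0)) γ₀ legal₀ (after-opening γ₀ legal₀ guarded₁)

module FiveSpokesFourMoves where

  open MakerStrategy 4 2 ℕₚ.≤-refl

  four-moves : MakerHasWinningStrategy W 4 n
  four-moves =
    let col₀ = emptyColouring W n
        γ₁ , legal₁ , guarded₁ , _ = colour-open-spoke {col₀} (λ _ _ ()) {# 0} refl
        col₁ = col₀ [ spoke (# 0) ≔ γ₁ ]
        γ₂ , legal₂ , guarded₂ , _ = colour-open-spoke {col₁} guarded₁ {# 1} refl
        col₂ = col₁ [ spoke (# 1) ≔ γ₂ ]
        γ₃ , legal₃ , guarded₃ , _ = colour-open-spoke {col₂} guarded₂ {# 3} refl
        col₃ = col₂ [ spoke (# 3) ≔ γ₃ ]
        γ₄ , legal₄ = rim-colourable {col = col₃} ℕₚ.≤-refl {# 0} refl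
        col₄ = col₃ [ rim (# 0) ≔ γ₄ ]
    in mMove (spoke (# 0)) γ₁ legal₁ (mMove (spoke (# 1)) γ₂ legal₂ (mMove (spoke (# 3)) γ₃ legal₃
         (mMove (rim (# 0)) γ₄ legal₄
         (breakerTurn _ ℕₚ.≤-refl
            (legal-proper (legal-proper (legal-proper (legal-proper empty-proper legal₁) legal₂) legal₃) legal₄)
            (guarded-rim-closed guarded₃ (λ ()) (λ ()) ,
             inj₂ (spare-apart {col₄} {# 2} {# 4} refl refl (λ ()) (λ { (inj₁ ()) ; (inj₂ ()) })) ,
             inj₂ (s≤s (s≤s z≤n)))))))

maker-wins-wheel : ∀ q mm → MakerHasWinningStrategy (Wheel (5 + q)) (2 + mm) (5 + q)
maker-wins-wheel (suc q) mm = MakerStrategy.maker-wins (4 + suc q) mm (ℕₚ.m≤m+n 4 (suc q)) (inj₁ (ℕₚ.m≤m+n 5 q))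
maker-wins-wheel zero 0 = FiveSpokesTwoMoves.two-moves
maker-wins-wheel zero 1 = MakerStrategy.maker-wins 4 1 ℕₚ.≤-refl (inj₂ (inj₂ refl))
maker-wins-wheel zero 2 = FiveSpokesFourMoves.four-moves
maker-wins-wheel zero (suc (suc (suc mm))) = MakerStrategy.maker-wins 4 (3 + mm) ℕₚ.≤-refl (inj₂ (inj₁ (ℕₚ.m≤m+n 5 mm)))

theorem4p3 : (m n : ℕ) → 2 ≤ m → 5 ≤ n → GameChromaticIndexIs (Wheel n) m n
theorem4p3 (suc (suc mm)) (suc (suc (suc (suc (suc q))))) (s≤s (s≤s z≤n)) (s≤s (s≤s (s≤s (s≤s (s≤s z≤n))))) =
  maker-wins-wheel q mm , λ _ → WheelGraph.fewer-colours-lose (4 + q)
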